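{- Let $\mathfrak X$ be a homogeneous tree of degree $q+1$ ($q\geq1$). Let $k\geq 0$ be an integer and let $Q=\sum_{i=0}^{k}c_i\mu_i$ be a linear operator on $\mathcal F(\mathfrak X)$, where $c_i\in\mathbb C$ and $c_k\neq 0$. Then $Q:\mathcal F(\mathfrak X)\to\mathcal F(\mathfrak X)$ is surjective.
   Context: $\mathfrak X$ is a tree in which every vertex has exactly $q+1$ edges; $d$ is the graph distance. $\mathcal F(\mathfrak X)$ is the space of complex-valued functions on the vertices. $S_k(v)=\{w:d(v,w)=k\}$. The spherical mean value operator is $\mu_0f=f$ and, for $k\geq1$, $\mu_kf(v)=\frac{1}{(q+1)q^{k-1}}\sum_{w\in S_k(v)}f(w)$. -}

module Defs where

open import Level using (Level; _⊔_) renaming (suc to lsuc)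
open import Data.Nat as ℕ using (ℕ; zero; suc; _∸_; _^_; _≤_)
open import Data.Nat.Properties using (m*n≢0; m^n≢0)
open import Data.Fin as Fin using (Fin)
open import Data.Bool using (Bool; true; false; T; not; _∧_; if_then_else_)
open import Data.Bool.Properties using (T?)
open import Data.List using (List; []; _∷_; map; concatMap; filter; mapMaybe; foldr; length)
open import Data.List.Base using (allFin)
open import Data.Maybe using (Maybe; just; nothing)
open import Data.Product using (Σ; _,_; proj₁)
open import Relation.Nullary using (¬_; yes; no)
open import Relation.Nullary.Decidable using (⌊_⌋)
open import Relation.Binary.PropositionalEquality using (_≢_)
open import Algebra.Bundles using (CommutativeRing; Semiring)
import Algebra.Definitions.RawSemiring as RS

-- Scalars: a field of characteristic zero (stand-in for ℂ)

record Field (c ℓ : Level) : Set (lsuc (c ⊔ ℓ)) where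
  field
    commutativeRing : CommutativeRing c ℓ
  open CommutativeRing commutativeRing public
  open RS (Semiring.rawSemiring semiring) public using (_×_)
  field
    0≉1        : ¬ (0# ≈ 1#)
    inv        : (x : Carrier) → ¬ (x ≈ 0#) → Carrier
    inv-inverse : ∀ x (x≉0 : ¬ (x ≈ 0#)) → x * inv x x≉0 ≈ 1#

record CharZeroField (c ℓ : Level) : Set (lsuc (c ⊔ ℓ)) where
  field
    field′ : Field c ℓ
  open Field field′ public
  field
    char0 : ∀ (n : ℕ) → n ≢ 0 → ¬ ((n × 1#) ≈ 0#)

-- The homogeneous tree of degree q+1, realised as the Cayley graph of the
-- free product of q+1 copies of ℤ/2: vertices are reduced words over the
-- alphabet Fin (q+1) (no two consecutive equal letters); w ~ w·a.

reduced : ∀ {m} → List (Fin m) → Bool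
reduced []            = true
reduced (a ∷ [])      = true
reduced (a ∷ b ∷ w)   = not ⌊ a Fin.≟ b ⌋ ∧ reduced (b ∷ w)

Vertex : ℕ → Set
Vertex q = Σ (List (Fin (suc q))) (λ w → T (reduced w))

len : ∀ {q} → Vertex q → ℕ
len (w , _) = length w

lcp : ∀ {m} → List (Fin m) → List (Fin m) → ℕ
lcp (a ∷ u) (b ∷ w) = if ⌊ a Fin.≟ b ⌋ then suc (lcp u w) else 0
lcp _ _ = 0

dist : ∀ {q} → Vertex q → Vertex q → ℕ
dist (u , _) (w , _) = (length u ℕ.+ length w) ∸ (2 ℕ.* lcp u w)

words : ∀ m → ℕ → List (List (Fin m))
words m zero    = [] ∷ []
words m (suc n) = [] ∷ concatMap (λ a → map (a ∷_) (words m n)) (allFin m)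

toVertex : ∀ {q} → List (Fin (suc q)) → Maybe (Vertex q)
toVertex w with T? (reduced w)
... | yes p = just (w , p)
... | no _  = nothing

ball : ∀ q → ℕ → List (Vertex q)
ball q n = mapMaybe toVertex (words (suc q) n)

-- the sphere S_k(v) = {w : d(v,w) = k}, as a finite list (every such w
-- has length ≤ |v| + k)
sphere : ∀ {q} → Vertex q → ℕ → List (Vertex q)
sphere {q} v k = filter (λ w → dist v w ℕ.≟ k) (ball q (len v ℕ.+ k))

module _ {c ℓ} (K : CharZeroField c ℓ) where
  open CharZeroField K

  Fun : ℕ → Set c
  Fun q = Vertex q → Carrier

  sumOver : ∀ {q} → List (Vertex q) → Fun q → Carrier
  sumOver vs f = foldr (λ w s → f w + s) 0# vs

  -- normalising constant (q+1) q^(k-1) for μ_k, k ≥ 1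
  normConst : ℕ → ℕ → ℕ
  normConst q k = suc q ℕ.* (q ^ k)

  normConst≢0 : ∀ q k → 1 ≤ q → normConst q k ≢ 0
  normConst≢0 (suc q) k _ =
    ℕ.≢-nonZero⁻¹ (suc (suc q) ℕ.* (suc q ^ k))
      {{m*n≢0 (suc (suc q)) (suc q ^ k) {{_}} {{m^n≢0 (suc q) k}}}}

  μ : ∀ q → 1 ≤ q → ℕ → Fun q → Fun q
  μ q q≥1 zero    f v = f v
  μ q q≥1 (suc k) f v =
    inv (normConst q k × 1#) (char0 (normConst q k) (normConst≢0 q k q≥1))
      * sumOver (sphere v (suc k)) f

  Q : ∀ q → 1 ≤ q → (k : ℕ) → (Fin (suc k) → Carrier) → Fun q → Fun q
  Q q q≥1 k coeff f v =
    foldr (λ i s → coeff i * μ q q≥1 (Fin.toℕ i) f v + s) 0# (allFin (suc k))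

{-# OPTIONS --safe #-}
-- Solve Q f = g level by level, the level |w| of a vertex being its distance from the root.
-- The ball of radius k about v meets level n = |v| + k exactly in the k-th descendants of v
-- and meets no higher level.  So once f is fixed below level n, setting f = a on those
-- descendants changes Q f (v) by a δ(v), where δ(v) = c_k μ_k 1_{level n} (v) is c_k times a
-- positive count over (q+1) q^(k-1), hence nonzero in characteristic 0.  One choice of a
-- solves the equation at v and no later level disturbs it; as each vertex of level n ≥ k has
-- a unique ancestor at level n - k, the choices made for different v never conflict.
module Submission where

open import Defs
open import Data.Nat as ℕ using (ℕ; zero; suc; _≤_; _<_; z≤n; s≤s)
import Data.Nat.Properties as ℕₚ
open import Data.Fin as Fin using (Fin; fromℕ; toℕ; inject₁)
open import Data.Fin.Properties using (toℕ-fromℕ; toℕ-inject₁; toℕ<n; toℕ≤pred[n])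
open import Data.List using (List; []; _∷_; length; take; map; foldr; filter; tabulate; allFin)
open import Data.List.Properties using (take-all; ∷-injective)
open import Data.List.Membership.Propositional using (_∈_)
open import Data.List.Membership.Propositional.Properties
  using (∈-map⁺; ∈-concatMap⁺; ∈-allFin; ∈-filter⁺; ∈-filter⁻; ∈-length)
open import Data.List.Relation.Unary.Any as Any using (here; there)
open import Data.List.Relation.Unary.Any.Properties using (mapMaybe⁺)
open import Data.Bool using (T)
open import Data.Bool.Properties using (T?; T-∧; T-irrelevant)
open import Data.Maybe using (just)
import Data.Maybe.Relation.Unary.Any as Maybe
open import Data.Product using (∃; _,_; proj₁; proj₂)
open import Data.Empty using (⊥-elim)
open import Data.Sum using (_⊎_; inj₁; inj₂)
open import Function.Bundles using (Equivalence)
open import Relation.Nullary using (¬_; Dec; yes; no)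
open import Relation.Unary using (Pred; Decidable)
open import Relation.Binary.PropositionalEquality as ≡ using (_≡_; _≢_)
open import Algebra.Bundles using (CommutativeRing; Semiring)
import Algebra.Definitions.RawSemiring as RawSemiringDefinitions
import Relation.Binary.Reasoning.Setoid as SetoidReasoning

module TreeGeometry where
  open import Data.Nat using (_+_; _*_; _∸_)
  open import Data.Nat.Properties
  open import Data.Nat.Tactic.RingSolver using (solve-∀)
  open import Data.Product using (∃₂; _×_)
  open import Relation.Binary.PropositionalEquality

  m+n≡m⇒n≡0 : ∀ m {n} → m + n ≡ m → n ≡ 0
  m+n≡m⇒n≡0 m {n} eq = +-cancelˡ-≡ m n 0 (trans eq (sym (+-identityʳ m)))

  module _ {m : ℕ} where

    lcp-split : (u w : List (Fin m)) →
                ∃₂ λ x y → length u ≡ lcp u w + x × length w ≡ lcp u w + y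
    lcp-split []      w       = 0 , length w , refl , refl
    lcp-split (a ∷ u) []      = suc (length u) , 0 , refl , refl
    lcp-split (a ∷ u) (b ∷ w) with a Fin.≟ b
    ... | no _  = suc (length u) , suc (length w) , refl , refl
    ... | yes _ with lcp-split u w
    ...   | x , y , u≡ , w≡ = x , y , cong suc u≡ , cong suc w≡

    lcp≡length⇒take≡ : (u w : List (Fin m)) → lcp u w ≡ length u → take (length u) w ≡ u
    lcp≡length⇒take≡ []      w       _  = refl
    lcp≡length⇒take≡ (a ∷ u) (b ∷ w) eq with a Fin.≟ b | eq
    ... | yes refl | eq′ = cong (a ∷_) (lcp≡length⇒take≡ u w (suc-injective eq′))
    ... | no _     | ()

    take≡⇒lcp≡length : (u w : List (Fin m)) → take (length u) w ≡ u → lcp u w ≡ length u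
    take≡⇒lcp≡length []      w       _  = refl
    take≡⇒lcp≡length (a ∷ u) (b ∷ w) eq with a Fin.≟ b | ∷-injective eq
    ... | yes _ | _ , eq′   = cong suc (take≡⇒lcp≡length u w eq′)
    ... | no b≢a | refl , _ = ⊥-elim (b≢a refl)

    reduced-tail : (a : Fin m) (w : List (Fin m)) → T (reduced (a ∷ w)) → T (reduced w)
    reduced-tail a []      _ = _
    reduced-tail a (b ∷ w) r = proj₂ (Equivalence.to T-∧ r)

    reduced-take : (j : ℕ) (w : List (Fin m)) → T (reduced w) → T (reduced (take j w))
    reduced-take zero          w           _ = _
    reduced-take (suc j)       []          _ = _
    reduced-take (suc zero)    (a ∷ w)     _ = _
    reduced-take (suc (suc j)) (a ∷ [])    _ = _
    reduced-take (suc (suc j)) (a ∷ b ∷ w) r = Equivalence.from T-∧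
      (proj₁ (Equivalence.to T-∧ r) , reduced-take (suc j) (b ∷ w) (reduced-tail a (b ∷ w) r))

    ∈-words : (n : ℕ) (w : List (Fin m)) → length w ≤ n → w ∈ words m n
    ∈-words zero    []      _           = here refl
    ∈-words (suc n) []      _           = here refl
    ∈-words (suc n) (a ∷ w) (s≤s |w|≤n) =
      there (∈-concatMap⁺ (λ b → map (b ∷_) (words m n))
        (Any.map (λ { refl → ∈-map⁺ (a ∷_) (∈-words n w |w|≤n) }) (∈-allFin a)))

  module _ {q : ℕ} where

    _≼_ : Vertex q → Vertex q → Set
    v ≼ w = take (len v) (proj₁ w) ≡ proj₁ v

    ancestor : ℕ → Vertex q → Vertex q
    ancestor j (w , r) = take j w , reduced-take j w r

    ≡-vertex : {v w : Vertex q} → proj₁ v ≡ proj₁ w → v ≡ w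
    ≡-vertex {u , r} {.u , r′} refl = cong (u ,_) (T-irrelevant r r′)

    -- x is the distance from v up to the last common ancestor of v and w.
    dist-split : (v w : Vertex q) →
                 ∃ λ x → len v ≡ lcp (proj₁ v) (proj₁ w) + x × len v + dist v w ≡ len w + 2 * x
    dist-split (u , _) (w , _) with lcp-split u w
    ... | x , y , u≡ , w≡ = x , u≡ , (begin
      length u + dist′                   ≡⟨ cong₂ _+_ u≡ (cong₂ (λ a b → a + b ∸ 2 * l) u≡ w≡) ⟩
      l + x + ((l + x) + (l + y) ∸ 2 * l) ≡⟨ cong (λ s → l + x + (s ∸ 2 * l)) (regroup l x y) ⟩
      l + x + (2 * l + (x + y) ∸ 2 * l)   ≡⟨ cong (l + x +_) (m+n∸m≡n (2 * l) (x + y)) ⟩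
      l + x + (x + y)                     ≡⟨ shift l x y ⟩
      l + y + 2 * x                       ≡⟨ cong (_+ 2 * x) (sym w≡) ⟩
      length w + 2 * x                    ∎)
      where
      open ≡-Reasoning
      l = lcp u w
      dist′ = length u + length w ∸ 2 * l
      regroup : ∀ l x y → (l + x) + (l + y) ≡ 2 * l + (x + y)
      regroup = solve-∀
      shift : ∀ l x y → l + x + (x + y) ≡ l + y + 2 * x
      shift = solve-∀

    len≤len+dist : (v w : Vertex q) → len w ≤ len v + dist v w
    len≤len+dist v w with dist-split v w
    ... | x , _ , eq = subst (len w ≤_) (sym eq) (m≤m+n (len w) (2 * x))

    ≼⇒len+dist≡len : (v w : Vertex q) → v ≼ w → len v + dist v w ≡ len w
    ≼⇒len+dist≡len v w v≼w with dist-split v w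
    ... | x , len-v≡ , eq = trans eq (trans (cong (λ x → len w + 2 * x) x≡0) (+-identityʳ (len w)))
      where
      x≡0 : x ≡ 0
      x≡0 = m+n≡m⇒n≡0 (len v)
        (sym (trans len-v≡ (cong (_+ x) (take≡⇒lcp≡length (proj₁ v) (proj₁ w) v≼w))))

    len+dist≡len⇒≼ : (v w : Vertex q) → len v + dist v w ≡ len w → v ≼ w
    len+dist≡len⇒≼ v w eq with dist-split v w
    ... | x , len-v≡ , eq′ = lcp≡length⇒take≡ (proj₁ v) (proj₁ w) lcp≡len
      where
      x≡0 : x ≡ 0
      x≡0 = m+n≡0⇒m≡0 x (m+n≡m⇒n≡0 (len w) (trans (sym eq′) eq))
      lcp≡len : lcp (proj₁ v) (proj₁ w) ≡ len v
      lcp≡len = sym (trans len-v≡ (trans (cong (lcp (proj₁ v) (proj₁ w) +_) x≡0) (+-identityʳ _)))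

    ≼-refl : (v : Vertex q) → v ≼ v
    ≼-refl (u , _) = take-all (length u) u ≤-refl

    dist-self : (v : Vertex q) → dist v v ≡ 0
    dist-self v = m+n≡m⇒n≡0 (len v) (≼⇒len+dist≡len v v (≼-refl v))

    dist≤⇒≼ : (v w : Vertex q) (k : ℕ) → len w ≡ len v + k → dist v w ≤ k → v ≼ w
    dist≤⇒≼ v w k len-w≡ d≤k = len+dist≡len⇒≼ v w (trans (cong (len v +_) d≡k) (sym len-w≡))
      where
      d≡k : dist v w ≡ k
      d≡k = ≤-antisym d≤k (+-cancelˡ-≤ (len v) k (dist v w)
              (subst (_≤ len v + dist v w) len-w≡ (len≤len+dist v w)))

  module _ {q : ℕ} where
    Letter : Set
    Letter = Fin (suc (suc q))

    private
      other : Letter → Letter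
      other Fin.zero    = Fin.suc Fin.zero
      other (Fin.suc _) = Fin.zero

      zigzag : Letter → ℕ → List Letter
      zigzag a zero    = []
      zigzag a (suc j) = other a ∷ zigzag (other a) j

      reduced-zigzag : (a : Letter) (j : ℕ) → T (reduced (a ∷ zigzag a j))
      reduced-zigzag a           zero    = _
      reduced-zigzag Fin.zero    (suc j) = reduced-zigzag (Fin.suc Fin.zero) j
      reduced-zigzag (Fin.suc i) (suc j) = reduced-zigzag Fin.zero j

      length-zigzag : (a : Letter) (j : ℕ) → length (zigzag a j) ≡ j
      length-zigzag a zero    = refl
      length-zigzag a (suc j) = cong suc (length-zigzag (other a) j)

    extend : List Letter → ℕ → List Letter
    extend []          j = zigzag Fin.zero j
    extend (a ∷ [])    j = a ∷ zigzag a j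
    extend (a ∷ b ∷ w) j = a ∷ extend (b ∷ w) j

    reduced-extend : (w : List Letter) (j : ℕ) → T (reduced w) → T (reduced (extend w j))
    reduced-extend []              j _ = reduced-tail Fin.zero (zigzag Fin.zero j) (reduced-zigzag Fin.zero j)
    reduced-extend (a ∷ [])        j _ = reduced-zigzag a j
    reduced-extend (a ∷ b ∷ [])    j r = Equivalence.from T-∧ (proj₁ (Equivalence.to T-∧ r) , reduced-zigzag b j)
    reduced-extend (a ∷ b ∷ c ∷ w) j r = Equivalence.from T-∧
      (proj₁ (Equivalence.to T-∧ r) , reduced-extend (b ∷ c ∷ w) j (reduced-tail a (b ∷ c ∷ w) r))

    length-extend : (w : List Letter) (j : ℕ) → length (extend w j) ≡ length w + j
    length-extend []          j = length-zigzag Fin.zero j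
    length-extend (a ∷ [])    j = cong suc (length-zigzag a j)
    length-extend (a ∷ b ∷ w) j = cong suc (length-extend (b ∷ w) j)

    take-extend : (w : List Letter) (j : ℕ) → take (length w) (extend w j) ≡ w
    take-extend []          j = refl
    take-extend (a ∷ [])    j = refl
    take-extend (a ∷ b ∷ w) j = cong (a ∷_) (take-extend (b ∷ w) j)

  ∃-descendant : ∀ {q} → 1 ≤ q → (v : Vertex q) (k : ℕ) →
                 ∃ λ w → dist v w ≡ k × len w ≡ len v + k
  ∃-descendant (s≤s z≤n) v@(u , r) k = w , d≡k , length-extend u k
    where
    w = extend u k , reduced-extend u k r
    d≡k : dist v w ≡ k
    d≡k = +-cancelˡ-≡ (len v) _ k (trans (≼⇒len+dist≡len v w (take-extend u k)) (length-extend u k))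

  module _ {q : ℕ} where

    toVertex-reduced : (v : Vertex q) → toVertex (proj₁ v) ≡ just v
    toVertex-reduced (w , r) with T? (reduced w)
    ... | yes r′ = cong (λ r → just (w , r)) (T-irrelevant r′ r)
    ... | no ¬r  = ⊥-elim (¬r r)

    ∈-ball : (n : ℕ) (v : Vertex q) → len v ≤ n → v ∈ ball q n
    ∈-ball n v len≤n = mapMaybe⁺ toVertex (words (suc q) n) (Any.map
      (λ eq → subst (Maybe.Any (v ≡_)) (trans (sym (toVertex-reduced v)) eq) (Maybe.just refl))
      (∈-map⁺ toVertex (∈-words n (proj₁ v) len≤n)))

    ∈-sphere⁺ : (v w : Vertex q) (k : ℕ) → dist v w ≡ k → w ∈ sphere v k
    ∈-sphere⁺ v w k d≡k = ∈-filter⁺ (λ w → dist v w ℕ.≟ k)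
      (∈-ball (len v + k) w (subst (λ d → len w ≤ len v + d) d≡k (len≤len+dist v w))) d≡k

    ∈-sphere⁻ : (v w : Vertex q) (k : ℕ) → w ∈ sphere v k → dist v w ≡ k
    ∈-sphere⁻ v w k w∈ = proj₂ (∈-filter⁻ (λ w → dist v w ℕ.≟ k) {xs = ball q (len v + k)} w∈)

open TreeGeometry

module Sums {c ℓ} (R : CommutativeRing c ℓ) where
  open CommutativeRing R
  open RawSemiringDefinitions (Semiring.rawSemiring semiring) using (_×_)
  open import Algebra.Solver.Ring.NaturalCoefficients.Default commutativeSemiring using (solve; _:+_; _:*_; _:=_)
  open SetoidReasoning setoid

  ∑ : {A : Set} → List A → (A → Carrier) → Carrier
  ∑ xs f = foldr (λ x s → f x + s) 0# xs

  module _ {A : Set} where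

    ∑-cong : (xs : List A) {f g : A → Carrier} → (∀ x → x ∈ xs → f x ≈ g x) → ∑ xs f ≈ ∑ xs g
    ∑-cong []       f≈g = refl
    ∑-cong (x ∷ xs) f≈g = +-cong (f≈g x (here ≡.refl)) (∑-cong xs (λ y y∈ → f≈g y (there y∈)))

    ∑-≈0 : (xs : List A) {f : A → Carrier} → (∀ x → x ∈ xs → f x ≈ 0#) → ∑ xs f ≈ 0#
    ∑-≈0 []       f≈0 = refl
    ∑-≈0 (x ∷ xs) f≈0 = trans (+-cong (f≈0 x (here ≡.refl)) (∑-≈0 xs (λ y y∈ → f≈0 y (there y∈)))) (+-identityˡ 0#)

    ∑-linear : (xs : List A) (f g : A → Carrier) (a : Carrier) →
               ∑ xs (λ x → f x + a * g x) ≈ ∑ xs f + a * ∑ xs g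
    ∑-linear []       f g a = sym (trans (+-identityˡ _) (zeroʳ a))
    ∑-linear (x ∷ xs) f g a = begin
      (f x + a * g x) + ∑ xs (λ x → f x + a * g x) ≈⟨ +-congˡ (∑-linear xs f g a) ⟩
      (f x + a * g x) + (∑ xs f + a * ∑ xs g)      ≈⟨ interchange (f x) (g x) (∑ xs f) (∑ xs g) a ⟩
      (f x + ∑ xs f) + a * (g x + ∑ xs g)          ∎
      where
      interchange : ∀ b c B C a → (b + a * c) + (B + a * C) ≈ (b + B) + a * (c + C)
      interchange = solve 5 (λ b c B C a → (b :+ a :* c) :+ (B :+ a :* C) := (b :+ B) :+ a :* (c :+ C)) refl

  ∑-tabulate-last : {A : Set} (n : ℕ) (f : Fin (suc n) → A) (g : A → Carrier) →
                    (∀ i → g (f (inject₁ i)) ≈ 0#) → ∑ (tabulate f) g ≈ g (f (fromℕ n))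
  ∑-tabulate-last zero    f g _   = +-identityʳ _
  ∑-tabulate-last (suc n) f g g≈0 = trans
    (+-cong (g≈0 Fin.zero) (∑-tabulate-last n (λ i → f (Fin.suc i)) g (λ i → g≈0 (Fin.suc i))))
    (+-identityˡ _)

  indicator : ∀ {p} {P : Set p} → Dec P → Carrier
  indicator (yes _) = 1#
  indicator (no _)  = 0#

  module _ {p} {P : Set p} where

    indicator-yes : P → (d : Dec P) → indicator d ≈ 1#
    indicator-yes _ (yes _) = refl
    indicator-yes p (no ¬p) = ⊥-elim (¬p p)

    indicator-no : ¬ P → (d : Dec P) → indicator d ≈ 0#
    indicator-no ¬p (yes p) = ⊥-elim (¬p p)
    indicator-no _  (no _)  = refl

    *-indicator-cong : {a b : Carrier} → (P → a ≈ b) → (d : Dec P) → a * indicator d ≈ b * indicator d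
    *-indicator-cong a≈b (yes p) = *-congʳ (a≈b p)
    *-indicator-cong _   (no _)  = trans (zeroʳ _) (sym (zeroʳ _))

  ∑-indicator : ∀ {A : Set} {p} {P : Pred A p} (P? : Decidable P) (xs : List A) →
                ∑ xs (λ x → indicator (P? x)) ≈ length (filter P? xs) × 1#
  ∑-indicator P? []       = refl
  ∑-indicator P? (x ∷ xs) with P? x
  ... | yes _ = +-congˡ (∑-indicator P? xs)
  ... | no _  = trans (+-identityˡ _) (∑-indicator P? xs)

module FieldProperties {c ℓ} (F : Field c ℓ) where
  open Field F
  open import Algebra.Solver.Ring.NaturalCoefficients.Default commutativeSemiring using (solve; _:*_; _:=_)
  open import Algebra.Properties.AbelianGroup +-abelianGroup using (xyx⁻¹≈y)
  open SetoidReasoning setoid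

  *-≉0 : ∀ {a b} → ¬ a ≈ 0# → ¬ b ≈ 0# → ¬ a * b ≈ 0#
  *-≉0 {a} {b} a≉0 b≉0 ab≈0 = b≉0 (begin
    b              ≈⟨ *-identityˡ b ⟨
    1# * b         ≈⟨ *-congʳ (inv-inverse a a≉0) ⟨
    (a * a⁻¹) * b  ≈⟨ solve 3 (λ a a⁻¹ b → (a :* a⁻¹) :* b := a⁻¹ :* (a :* b)) refl a a⁻¹ b ⟩
    a⁻¹ * (a * b)  ≈⟨ *-congˡ ab≈0 ⟩
    a⁻¹ * 0#       ≈⟨ zeroʳ a⁻¹ ⟩
    0#             ∎)
    where a⁻¹ = inv a a≉0

  inv-≉0 : ∀ a (a≉0 : ¬ a ≈ 0#) → ¬ inv a a≉0 ≈ 0#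
  inv-≉0 a a≉0 a⁻¹≈0 = 0≉1 (begin
    0#             ≈⟨ zeroʳ a ⟨
    a * 0#         ≈⟨ *-congˡ a⁻¹≈0 ⟨
    a * inv a a≉0  ≈⟨ inv-inverse a a≉0 ⟩
    1#             ∎)

  x+[y-x]*d⁻¹*d≈y : ∀ x y d (d≉0 : ¬ d ≈ 0#) → x + ((y - x) * inv d d≉0) * d ≈ y
  x+[y-x]*d⁻¹*d≈y x y d d≉0 = begin
    x + ((y - x) * d⁻¹) * d  ≈⟨ +-congˡ (reassociate (y - x) d d⁻¹) ⟩
    x + (y - x) * (d * d⁻¹)  ≈⟨ +-congˡ (*-congˡ (inv-inverse d d≉0)) ⟩
    x + (y - x) * 1#         ≈⟨ +-congˡ (*-identityʳ (y - x)) ⟩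
    x + (y - x)              ≈⟨ +-assoc x y (- x) ⟨
    x + y - x                ≈⟨ xyx⁻¹≈y x y ⟩
    y                        ∎
    where
    d⁻¹ = inv d d≉0
    reassociate : ∀ a d d⁻¹ → (a * d⁻¹) * d ≈ a * (d * d⁻¹)
    reassociate = solve 3 (λ a d d⁻¹ → (a :* d⁻¹) :* d := a :* (d :* d⁻¹)) refl

module CharZeroProperties {c ℓ} (K : CharZeroField c ℓ) where
  open CharZeroField K
  open Sums commutativeRing

  ∑-indicator-≉0 : ∀ {A : Set} {p} {P : Pred A p} (P? : Decidable P) {xs : List A} {x : A} →
                   x ∈ xs → P x → ¬ ∑ xs (λ y → indicator (P? y)) ≈ 0#
  ∑-indicator-≉0 P? {xs} x∈xs px ∑≈0 =
    char0 (length (filter P? xs)) (λ len≡0 → ℕₚ.<⇒≢ (∈-length (∈-filter⁺ P? x∈xs px)) (≡.sym len≡0))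
      (trans (sym (∑-indicator P? xs)) ∑≈0)

module Operators {c ℓ} (K : CharZeroField c ℓ) {q : ℕ} (q≥1 : 1 ≤ q) where
  open CharZeroField K
  open Sums commutativeRing
  open FieldProperties field′
  open CharZeroProperties K
  open import Algebra.Solver.Ring.NaturalCoefficients.Default commutativeSemiring using (solve; _:+_; _:*_; _:=_)

  private
    V  = Vertex q
    μ′ = μ K q q≥1
    Q′ = Q K q q≥1

    *-linear : ∀ c x a y → c * (x + a * y) ≈ c * x + a * (c * y)
    *-linear = solve 4 (λ c x a y → c :* (x :+ a :* y) := c :* x :+ a :* (c :* y)) refl

  μ-local : (i : ℕ) (v : V) {f g : Fun K q} → (∀ w → dist v w ≡ i → f w ≈ g w) → μ′ i f v ≈ μ′ i g v
  μ-local zero    v f≈g = f≈g v (dist-self v)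
  μ-local (suc i) v f≈g = *-congˡ (∑-cong (sphere v (suc i)) (λ w w∈ → f≈g w (∈-sphere⁻ v w (suc i) w∈)))

  μ-≈0 : (i : ℕ) (v : V) {f : Fun K q} → (∀ w → dist v w ≡ i → f w ≈ 0#) → μ′ i f v ≈ 0#
  μ-≈0 zero    v f≈0 = f≈0 v (dist-self v)
  μ-≈0 (suc i) v f≈0 =
    trans (*-congˡ (∑-≈0 (sphere v (suc i)) (λ w w∈ → f≈0 w (∈-sphere⁻ v w (suc i) w∈)))) (zeroʳ _)

  μ-linear : (i : ℕ) (v : V) (f g : Fun K q) (a : Carrier) →
             μ′ i (λ w → f w + a * g w) v ≈ μ′ i f v + a * μ′ i g v
  μ-linear zero    v f g a = refl
  μ-linear (suc i) v f g a =
    trans (*-congˡ (∑-linear (sphere v (suc i)) f g a)) (*-linear _ _ a _)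

  Q-local : (k : ℕ) (coeff : Fin (suc k) → Carrier) (v : V) {f g : Fun K q} →
            (∀ w → dist v w ≤ k → f w ≈ g w) → Q′ k coeff f v ≈ Q′ k coeff g v
  Q-local k coeff v f≈g = ∑-cong (allFin (suc k)) λ i _ →
    *-congˡ (μ-local (toℕ i) v (λ w d≡i → f≈g w (≡.subst (_≤ k) (≡.sym d≡i) (toℕ≤pred[n] i))))

  Q-linear : (k : ℕ) (coeff : Fin (suc k) → Carrier) (v : V) (f g : Fun K q) (a : Carrier) →
             Q′ k coeff (λ w → f w + a * g w) v ≈ Q′ k coeff f v + a * Q′ k coeff g v
  Q-linear k coeff v f g a = trans
    (∑-cong (allFin (suc k)) (λ i _ → trans (*-congˡ (μ-linear (toℕ i) v f g a)) (*-linear _ _ a _)))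
    (∑-linear (allFin (suc k)) _ _ a)

  Q-top : (k : ℕ) (coeff : Fin (suc k) → Carrier) (v : V) {f : Fun K q} →
          (∀ i → i < k → μ′ i f v ≈ 0#) → Q′ k coeff f v ≈ coeff (fromℕ k) * μ′ k f v
  Q-top k coeff v {f} f≈0 = trans
    (∑-tabulate-last k (λ i → i) (λ i → coeff i * μ′ (toℕ i) f v) λ i →
      trans (*-congˡ (f≈0 _ (≡.subst (_< k) (≡.sym (toℕ-inject₁ i)) (toℕ<n i)))) (zeroʳ _))
    (reflexive (≡.cong (λ j → coeff (fromℕ k) * μ′ j f v) (toℕ-fromℕ k)))

  level : ℕ → Fun K q
  level n w = indicator (len w ℕ.≟ n)

  μ-level-≈0 : (i n : ℕ) (v : V) → len v ℕ.+ i < n → μ′ i (level n) v ≈ 0#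
  μ-level-≈0 i n v lt = μ-≈0 i v λ w d≡i → indicator-no
    (ℕₚ.<⇒≢ (ℕₚ.≤-<-trans (≡.subst (λ d → len w ≤ len v ℕ.+ d) d≡i (len≤len+dist v w)) lt)) (len w ℕ.≟ n)

  μ-level-≉0 : (k : ℕ) (v : V) → ¬ μ′ k (level (len v ℕ.+ k)) v ≈ 0#
  μ-level-≉0 zero    v μ≈0 =
    0≉1 (trans (sym μ≈0) (indicator-yes (≡.sym (ℕₚ.+-identityʳ (len v))) (len v ℕ.≟ len v ℕ.+ 0)))
  μ-level-≉0 (suc j) v =
    *-≉0 (inv-≉0 _ _) (∑-indicator-≉0 (λ w → len w ℕ.≟ len v ℕ.+ suc j) w∈S len-w≡)
    where
    w = proj₁ (∃-descendant q≥1 v (suc j))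
    w∈S = ∈-sphere⁺ v w (suc j) (proj₁ (proj₂ (∃-descendant q≥1 v (suc j))))
    len-w≡ = proj₂ (proj₂ (∃-descendant q≥1 v (suc j)))

module LevelwiseSolution {c ℓ} (K : CharZeroField c ℓ) {q : ℕ} (q≥1 : 1 ≤ q) (k : ℕ)
  (coeff : Fin (suc k) → CharZeroField.Carrier K)
  (top≉0 : ¬ CharZeroField._≈_ K (coeff (fromℕ k)) (CharZeroField.0# K))
  (g : Fun K q) where
  open CharZeroField K
  open Sums commutativeRing
  open FieldProperties field′
  open Operators K q≥1
  open SetoidReasoning setoid

  private
    Qₖ = Q K q q≥1 k coeff

  δ : Vertex q → Carrier
  δ v = Qₖ (level (len v ℕ.+ k)) v

  δ≉0 : (v : Vertex q) → ¬ δ v ≈ 0#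
  δ≉0 v δ≈0 = *-≉0 top≉0 (μ-level-≉0 k v) (trans (sym (Q-top k coeff v below)) δ≈0)
    where
    below : ∀ i → i < k → μ K q q≥1 i (level (len v ℕ.+ k)) v ≈ 0#
    below i i<k = μ-level-≈0 i (len v ℕ.+ k) v (ℕₚ.+-monoʳ-< (len v) i<k)

  correction : Fun K q → Vertex q → Carrier
  correction f v = (g v - Qₖ f v) * inv (δ v) (δ≉0 v)

  -- Levels n < k carry no equation of their own; there n ∸ k = 0, so the root's correction is
  -- used, an arbitrary choice.
  approx : ℕ → Fun K q
  approx zero    w = 0#
  approx (suc n) w = approx n w + correction (approx n) (ancestor (n ℕ.∸ k) w) * level n w

  solution : Fun K q
  solution w = approx (suc (len w)) w

  approx-suc-off-level : (n : ℕ) (w : Vertex q) → len w ≢ n → approx (suc n) w ≈ approx n w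
  approx-suc-off-level n w len≢n =
    trans (+-congˡ (trans (*-congˡ (indicator-no len≢n (len w ℕ.≟ n))) (zeroʳ _))) (+-identityʳ _)

  approx-stable : (n : ℕ) (w : Vertex q) → len w < n → approx n w ≈ solution w
  approx-stable (suc n) w (s≤s len≤n) = stable (ℕₚ.m≤n⇒m<n∨m≡n len≤n)
    where
    stable : len w < n ⊎ len w ≡ n → approx (suc n) w ≈ solution w
    stable (inj₁ len<n)  = trans (approx-suc-off-level n w (ℕₚ.<⇒≢ len<n)) (approx-stable n w len<n)
    stable (inj₂ ≡.refl) = refl

  approx-step : (v w : Vertex q) → dist v w ≤ k →
                let n = len v ℕ.+ k in approx (suc n) w ≈ approx n w + correction (approx n) v * level n w
  approx-step v w d≤k = +-congˡ (*-indicator-cong ancestor≡ (len w ℕ.≟ len v ℕ.+ k))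
    where
    ancestor≡ : len w ≡ len v ℕ.+ k → correction _ (ancestor (len v ℕ.+ k ℕ.∸ k) w) ≈ correction _ v
    ancestor≡ len-w≡ = reflexive (≡.cong (correction _) (≡.trans
      (≡.cong (λ j → ancestor j w) (ℕₚ.m+n∸n≡m (len v) k))
      (≡-vertex (dist≤⇒≼ v w k len-w≡ d≤k))))

  solution-correct : (v : Vertex q) → Qₖ solution v ≈ g v
  solution-correct v = begin
    Qₖ solution v
      ≈⟨ Q-local k coeff v (λ w d≤k → sym (approx-stable (suc n) w (s≤s (within w d≤k)))) ⟩
    Qₖ (approx (suc n)) v
      ≈⟨ Q-local k coeff v (approx-step v) ⟩
    Qₖ (λ w → approx n w + a * level n w) v
      ≈⟨ Q-linear k coeff v (approx n) (level n) a ⟩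
    Qₖ (approx n) v + a * δ v
      ≈⟨ x+[y-x]*d⁻¹*d≈y (Qₖ (approx n) v) (g v) (δ v) (δ≉0 v) ⟩
    g v ∎
    where
    n = len v ℕ.+ k
    a = correction (approx n) v
    within : ∀ w → dist v w ≤ k → len w ≤ n
    within w d≤k = ℕₚ.≤-trans (len≤len+dist v w) (ℕₚ.+-monoʳ-≤ (len v) d≤k)

theorem2p2 : ∀ {c ℓ} (K : CharZeroField c ℓ) (q : ℕ) (q≥1 : 1 ≤ q) (k : ℕ)
               (coeff : Fin (suc k) → CharZeroField.Carrier K) →
               ¬ (CharZeroField._≈_ K (coeff (fromℕ k)) (CharZeroField.0# K)) →
               ∀ (g : Fun K q) → ∃ λ (f : Fun K q) →
                 ∀ v → CharZeroField._≈_ K (Q K q q≥1 k coeff f v) (g v)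
theorem2p2 K q q≥1 k coeff top≉0 g = solution , solution-correct
  where open LevelwiseSolution K q≥1 k coeff top≉0 g
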